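{- Let $I_1$ and $I_2$ be inputs with $I_2$ a subsequence of $I_1$. Let $S_1$ and $S_2$ be proper outputs on $I_1$ and $I_2$ respectively, with initial runs $r_1$ and $r_2$ respectively, where $r_1$ and $r_2$ have the same direction (both increasing or both decreasing). Let $I_1'$ and $I_2'$ be the unwritten-element sequences after $r_1$ and $r_2$ are written, respectively. Then $I_2'$ is a subsequence of $I_1'$.
   Context: Up-down run generation problem: an input stream of elements from a totally ordered set is presented in order to an algorithm with a buffer of $M$ slots; the algorithm reads elements in order into the buffer and writes elements from the buffer to an output sequence, each write freeing a slot that is filled by the next input element. A run is a sorted (increasing) or reverse-sorted (decreasing) sequence. A maximal increasing run is written by starting with the smallest buffered element, always writing the smallest buffered element larger than the last element written, and ending only when every buffered element is smaller than the last written; maximal decreasing runs are symmetric. A proper algorithm always writes maximal runs, and a proper output is one produced by a proper algorithm. The unwritten-element sequence at a given time is the buffer contents (in order of arrival in the input) followed by the not-yet-read remainder of the input. -}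

module Defs where

open import Level using (Level; _⊔_)
open import Data.Nat using (ℕ)
open import Data.List using (List; []; _∷_; _++_; take; drop)
open import Data.List.Relation.Unary.All using (All)
open import Relation.Binary.Core using (Rel)
open import Relation.Binary.PropositionalEquality using (_≡_)
open import Relation.Nullary using (¬_)
open import Function using (flip)

-- Up-down run generation with a buffer of M slots, over elements of a type A
-- ordered by a strict relation _<_ (assumed to be a strict total order in the
-- statement).
module UpDown {a ℓ : Level} {A : Set a} (_<_ : Rel A ℓ) where

  -- State of the algorithm: buffer contents (in order of arrival) and the
  -- not-yet-read remainder of the input.
  record State : Set a where
    constructor ⟨_,_⟩
    field
      buf : List A
      inp : List A
  open State public

  unwritten : State → List A
  unwritten s = buf s ++ inp s

  initial : ℕ → List A → State
  initial M I = ⟨ take M I , drop M I ⟩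

  -- Writing the element x of a buffer  xs ++ x ∷ ys  frees its slot, which is
  -- filled by the next input element (if any), appended in arrival order.
  afterWrite : List A → List A → List A → State
  afterWrite xs ys rest = ⟨ xs ++ ys ++ take 1 rest , drop 1 rest ⟩

  data Dir : Set where
    up down : Dir

  _≺[_]_ : A → Dir → A → Set ℓ
  x ≺[ up ] y = x < y
  x ≺[ down ] y = y < x

  -- Continuation of a maximal run in direction d, after last written element
  -- `last`; `From d last s w s'` : starting in state s, the run writes the
  -- elements w and ends in state s'.
  data From (d : Dir) (last : A) : State → List A → State → Set (a ⊔ ℓ) where
    stop : ∀ {s} →
           All (λ y → y ≺[ d ] last) (buf s) →
           From d last s [] s
    next : ∀ {s xs x ys w s'} →
           buf s ≡ xs ++ x ∷ ys →
           last ≺[ d ] x →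
           All (λ y → last ≺[ d ] y → ¬ (y ≺[ d ] x)) (buf s) →
           From d x (afterWrite xs ys (inp s)) w s' →
           From d last s (x ∷ w) s'

  data Run (d : Dir) : State → List A → State → Set (a ⊔ ℓ) where
    run : ∀ {s xs x ys w s'} →
          buf s ≡ xs ++ x ∷ ys →
          All (λ y → ¬ (y ≺[ d ] x)) (buf s) →
          From d x (afterWrite xs ys (inp s)) w s' →
          Run d s (x ∷ w) s'

  data Proper : State → List A → Set (a ⊔ ℓ) where
    finish : ∀ {s} → unwritten s ≡ [] → Proper s []
    more   : ∀ {s r s' S} (d : Dir) → Run d s r s' → Proper s' S → Proper s (r ++ S)

-- Simulate the two first runs in lockstep, merging their write
-- sequences in the common direction: whichever run is about to write the
-- smaller element writes it (both write when the elements coincide). Along the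
-- way, every element still unwritten on I₂ is unwritten on I₁, and every
-- element that the current run on I₁ will still write and that is unwritten on
-- I₂ will also be written by the current run on I₂. The one delicate point is
-- that run 1 never reads an element that run 2 has not read yet: otherwise the
-- full buffer of run 2 (M elements) would fit into the M − 1 elements left in
-- the buffer of run 1. The resulting set inclusion is a subsequence relation
-- because both unwritten sequences are subsequences of the duplicate-free I₁.
module Submission where

open import Defs
open import Data.Nat using (ℕ)
open import Data.List using (List; _++_)
open import Data.List.Relation.Binary.Sublist.Propositional using (_⊆_)
open import Data.List.Relation.Unary.Unique.Propositional using (Unique)
open import Relation.Binary.Core using (Rel)
open import Relation.Binary.Structures using (IsStrictTotalOrder)
open import Relation.Binary.PropositionalEquality using (_≡_)

open import Data.Empty using (⊥; ⊥-elim)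
open import Data.List using ([]; _∷_; [_]; take; drop; length)
open import Data.List.Properties using (++-assoc; ++-identityʳ; take++drop≡id; length-++; length-++-sucʳ)
open import Data.List.Membership.Propositional using (_∈_; _∉_)
open import Data.List.Membership.Propositional.Properties using (∈-++⁺ˡ; ∈-++⁺ʳ; ∈-++⁻; ∈-insert)
open import Data.List.Relation.Binary.Sublist.Propositional using ([]; _∷_; _∷ʳ_; ⊆-refl; ⊆-trans; ⊆-reflexive; from∈)
open import Data.List.Relation.Binary.Sublist.Propositional.Properties
  using (++⁺; ++⁺ˡ; ++⁺ʳ; drop-⊆; drop⁺-⊆; All-resp-⊆; Any-resp-⊆; length-mono-≤)
open import Data.List.Relation.Binary.Subset.Propositional using () renaming (_⊆_ to _⊑_)
import Data.List.Relation.Unary.All as All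
open import Data.List.Relation.Unary.AllPairs using ([]; _∷_)
open import Data.List.Relation.Unary.Any using (here; there)
open import Data.List.Relation.Unary.Unique.Propositional.Properties using (Unique[x∷xs]⇒x∉xs)
open import Data.Maybe using (Maybe; just; nothing)
import Data.Maybe.Relation.Unary.All as Maybe
open import Data.Maybe.Relation.Unary.All using (just; nothing)
open import Data.Nat using (suc)
open import Data.Nat.Properties using (+-comm; 1+n≰n; module ≤-Reasoning)
open import Data.Product using (_×_; _,_; proj₁)
open import Data.Sum using (_⊎_; inj₁; inj₂)
open import Level using (_⊔_)
import Relation.Binary.Construct.Flip.EqAndOrd as Flip
open import Relation.Binary.Definitions using (tri<; tri≈; tri>)
open import Relation.Binary.PropositionalEquality using (_≢_; refl; sym; trans; cong; subst; subst₂; module ≡-Reasoning)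
open import Relation.Nullary using (¬_)

module _ {a} {A : Set a} where

  Unique-resp-⊇ : ∀ {xs ys : List A} → xs ⊆ ys → Unique ys → Unique xs
  Unique-resp-⊇ []         []        = []
  Unique-resp-⊇ (y ∷ʳ p)   (_ ∷ u)   = Unique-resp-⊇ p u
  Unique-resp-⊇ (refl ∷ p) (x≢ ∷ u)  = All-resp-⊆ p x≢ ∷ Unique-resp-⊇ p u

  there⁻ : ∀ {x y : A} {ys} → x ∈ y ∷ ys → x ≢ y → x ∈ ys
  there⁻ (here x≡y) x≢y = ⊥-elim (x≢y x≡y)
  there⁻ (there x∈) _   = x∈

  ⊆-delete : ∀ xs {m : A} {ys} → xs ++ ys ⊆ xs ++ m ∷ ys
  ⊆-delete xs {m} = ++⁺ (⊆-refl {x = xs}) (m ∷ʳ ⊆-refl)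

  ∈-delete : ∀ xs {x m : A} {ys} → x ∈ xs ++ m ∷ ys → x ≢ m → x ∈ xs ++ ys
  ∈-delete []       x∈         x≢m = there⁻ x∈ x≢m
  ∈-delete (_ ∷ xs) (here x≡y) _   = here x≡y
  ∈-delete (_ ∷ xs) (there x∈) x≢m = there (∈-delete xs x∈ x≢m)

  ∈-delete⇒≢ : ∀ xs {x m : A} {ys} → Unique (xs ++ m ∷ ys) → x ∈ xs ++ ys → x ≢ m
  ∈-delete⇒≢ []       (m∉ ∷ _) x∈          refl = All.lookup m∉ x∈ refl
  ∈-delete⇒≢ (_ ∷ xs) (x∉ ∷ _) (here refl) refl = All.lookup x∉ (∈-insert xs) refl
  ∈-delete⇒≢ (_ ∷ xs) (_ ∷ u)  (there x∈)       = ∈-delete⇒≢ xs u x∈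

  ∈-take-1 : ∀ {x : A} xs → x ∈ take 1 xs → xs ≡ x ∷ drop 1 xs
  ∈-take-1 (_ ∷ _) (here refl) = refl

  ∈-head-or-drop-1 : ∀ {x : A} xs → x ∈ xs → xs ≡ x ∷ drop 1 xs ⊎ x ∈ drop 1 xs
  ∈-head-or-drop-1 (_ ∷ _) (here refl) = inj₁ refl
  ∈-head-or-drop-1 (_ ∷ _) (there x∈)  = inj₂ x∈

  ∈-drop⇒length-take : ∀ n (xs : List A) {x} → x ∈ drop n xs → length (take n xs) ≡ n
  ∈-drop⇒length-take 0       _        _  = refl
  ∈-drop⇒length-take (suc n) (_ ∷ xs) x∈ = cong suc (∈-drop⇒length-take n xs x∈)

  length-refill : ∀ xs ys {m r : A} → length (xs ++ ys ++ [ r ]) ≡ length (xs ++ m ∷ ys)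
  length-refill []       ys = trans (length-++ ys) (+-comm (length ys) 1)
  length-refill (_ ∷ xs) ys = cong suc (length-refill xs ys)

  ⊑⇒⊆ : ∀ {xs ys zs : List A} → Unique zs → xs ⊆ zs → ys ⊆ zs → xs ⊑ ys → xs ⊆ ys
  ⊑⇒⊆ []       []         []         _     = []
  ⊑⇒⊆ (_ ∷ u)  (z ∷ʳ p)   (.z ∷ʳ q)  xs⊑ys = ⊑⇒⊆ u p q xs⊑ys
  ⊑⇒⊆ (z∉ ∷ u) (z ∷ʳ p)   (refl ∷ q) xs⊑ys =
    z ∷ʳ ⊑⇒⊆ u p q (λ x∈ → there⁻ (xs⊑ys x∈) (λ { refl → All.lookup z∉ (Any-resp-⊆ p x∈) refl }))
  ⊑⇒⊆ (z∉ ∷ u) (refl ∷ p) (z ∷ʳ q)   xs⊑ys = ⊥-elim (All.lookup z∉ (Any-resp-⊆ q (xs⊑ys (here refl))) refl)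
  ⊑⇒⊆ (z∉ ∷ u) (refl ∷ p) (refl ∷ q) xs⊑ys =
    refl ∷ ⊑⇒⊆ u p q (λ x∈ → there⁻ (xs⊑ys (there x∈)) (λ { refl → All.lookup z∉ (Any-resp-⊆ p x∈) refl }))

  Precedes : A → A → List A → Set a
  Precedes x y zs = x ∷ y ∷ [] ⊆ zs

  precedes-++ : ∀ {x y : A} {xs ys} → x ∈ xs → y ∈ ys → Precedes x y (xs ++ ys)
  precedes-++ x∈ y∈ = ++⁺ (from∈ x∈) (from∈ y∈)

  precedes-asym : ∀ {x y : A} {zs} → Unique zs → Precedes x y zs → Precedes y x zs → ⊥
  precedes-asym (_ ∷ u)  (z ∷ʳ p)   (.z ∷ʳ q)  = precedes-asym u p q
  precedes-asym (z∉ ∷ _) (z ∷ʳ p)   (refl ∷ _) = All.lookup z∉ (Any-resp-⊆ p (there (here refl))) refl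
  precedes-asym (z∉ ∷ _) (refl ∷ _) (z ∷ʳ q)   = All.lookup z∉ (Any-resp-⊆ q (there (here refl))) refl
  precedes-asym (z∉ ∷ _) (refl ∷ p) (refl ∷ _) = All.lookup z∉ (Any-resp-⊆ p (here refl)) refl

≺-isStrictTotalOrder : ∀ {a ℓ} {A : Set a} {_<_ : Rel A ℓ} → IsStrictTotalOrder _≡_ _<_ →
                       ∀ d → IsStrictTotalOrder _≡_ (λ x y → UpDown._≺[_]_ _<_ x d y)
≺-isStrictTotalOrder sto UpDown.up   = sto
≺-isStrictTotalOrder sto UpDown.down = Flip.isStrictTotalOrder sto

module Runs {a ℓ} {A : Set a} {_<_ : Rel A ℓ} (sto : IsStrictTotalOrder _≡_ _<_) (d : UpDown.Dir _<_) where
  open UpDown _<_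
  open IsStrictTotalOrder (≺-isStrictTotalOrder sto d) public
    using (compare) renaming (trans to ≺-trans; irrefl to ≺-irrefl; asym to ≺-asym)

  infix 4 _≺_ _⊏_

  _≺_ : A → A → Set ℓ
  x ≺ y = x ≺[ d ] y

  ≺-≮-trans : ∀ {x y z} → x ≺ y → ¬ z ≺ y → x ≺ z
  ≺-≮-trans {y = y} {z} x≺y z≮y with compare z y
  ... | tri< z≺y _ _ = ⊥-elim (z≮y z≺y)
  ... | tri≈ _ refl _ = x≺y
  ... | tri> _ _ y≺z = ≺-trans x≺y y≺z

  ≮∧≢⇒≻ : ∀ {x y} → ¬ x ≺ y → x ≢ y → y ≺ x
  ≮∧≢⇒≻ {x} {y} x≮y x≢y with compare x y
  ... | tri< x≺y _ _ = ⊥-elim (x≮y x≺y)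
  ... | tri≈ _ x≡y _ = ⊥-elim (x≢y x≡y)
  ... | tri> _ _ y≺x = y≺x

  _⊏_ : Maybe A → A → Set (a ⊔ ℓ)
  l ⊏ y = Maybe.All (_≺ y) l

  ⊏-≺-trans : ∀ {l x y} → l ⊏ x → x ≺ y → l ⊏ y
  ⊏-≺-trans (just l≺x) x≺y = just (≺-trans l≺x x≺y)
  ⊏-≺-trans nothing    _   = nothing

  Pending : Maybe A → State → A → Set (a ⊔ ℓ)
  Pending l s y = y ∈ buf s × l ⊏ y

  -- A run in progress after writing l (nothing before its first write): this
  -- merges Run (the first write) with From (the later ones).
  data Writes : Maybe A → State → List A → State → Set (a ⊔ ℓ) where
    stop : ∀ {l s} → (∀ {y} → ¬ Pending l s y) → Writes l s [] s
    next : ∀ {l s xs x ys w t} → buf s ≡ xs ++ x ∷ ys → l ⊏ x →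
           (∀ {y} → Pending l s y → ¬ y ≺ x) →
           Writes (just x) (afterWrite xs ys (inp s)) w t → Writes l s (x ∷ w) t

  From⇒Writes : ∀ {l s w t} → From d l s w t → Writes (just l) s w t
  From⇒Writes (stop below) = stop λ { (y∈ , just l≺y) → ≺-asym (All.lookup below y∈) l≺y }
  From⇒Writes (next eq l≺x minimal F) =
    next eq (just l≺x) (λ { (y∈ , just l≺y) → All.lookup minimal y∈ l≺y }) (From⇒Writes F)

  Run⇒Writes : ∀ {s w t} → Run d s w t → Writes nothing s w t
  Run⇒Writes (run eq minimal F) = next eq nothing (λ (y∈ , _) → All.lookup minimal y∈) (From⇒Writes F)

module States {a ℓ} {A : Set a} (_<_ : Rel A ℓ) where
  open UpDown _<_

  unwritten-afterWrite : ∀ xs ys R → unwritten (afterWrite xs ys R) ≡ xs ++ ys ++ R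
  unwritten-afterWrite xs ys R = begin
    (xs ++ ys ++ take 1 R) ++ drop 1 R  ≡⟨ ++-assoc xs (ys ++ take 1 R) (drop 1 R) ⟩
    xs ++ (ys ++ take 1 R) ++ drop 1 R  ≡⟨ cong (xs ++_) (++-assoc ys (take 1 R) (drop 1 R)) ⟩
    xs ++ ys ++ take 1 R ++ drop 1 R    ≡⟨ cong (λ zs → xs ++ ys ++ zs) (take++drop≡id 1 R) ⟩
    xs ++ ys ++ R                       ∎
    where open ≡-Reasoning

  afterWrite-⊆ : ∀ xs {m} ys R → unwritten (afterWrite xs ys R) ⊆ unwritten ⟨ xs ++ m ∷ ys , R ⟩
  afterWrite-⊆ xs {m} ys R =
    subst₂ _⊆_ (sym (unwritten-afterWrite xs ys R)) (sym (++-assoc xs (m ∷ ys) R)) (⊆-delete xs)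

  afterWrite-∋ : ∀ xs {m} ys R {x} → x ∈ unwritten ⟨ xs ++ m ∷ ys , R ⟩ → x ≢ m →
                 x ∈ unwritten (afterWrite xs ys R)
  afterWrite-∋ xs {m} ys R {x} x∈ x≢m = subst (x ∈_) (sym (unwritten-afterWrite xs ys R))
    (∈-delete xs (subst (x ∈_) (++-assoc xs (m ∷ ys) R) x∈) x≢m)

  afterWrite-∌ : ∀ xs {m} ys R {x} → Unique (unwritten ⟨ xs ++ m ∷ ys , R ⟩) →
                 x ∈ unwritten (afterWrite xs ys R) → x ≢ m
  afterWrite-∌ xs {m} ys R {x} u x∈ = ∈-delete⇒≢ xs (subst Unique (++-assoc xs (m ∷ ys) R) u)
    (subst (x ∈_) (unwritten-afterWrite xs ys R) x∈)

  kept-⊆-buf : ∀ xs ys R → xs ++ ys ⊆ buf (afterWrite xs ys R)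
  kept-⊆-buf xs ys R = subst (xs ++ ys ⊆_) (++-assoc xs ys (take 1 R)) (++⁺ʳ (take 1 R) ⊆-refl)

  next-read-∈-buf : ∀ xs ys {R x rest} → R ≡ x ∷ rest → x ∈ buf (afterWrite xs ys R)
  next-read-∈-buf xs ys refl = ∈-++⁺ʳ xs (∈-++⁺ʳ ys (here refl))

  buf-afterWrite⁻ : ∀ xs ys R {x} → x ∈ buf (afterWrite xs ys R) → x ∈ xs ++ ys ⊎ R ≡ x ∷ drop 1 R
  buf-afterWrite⁻ xs ys R {x} x∈ with ∈-++⁻ (xs ++ ys) (subst (x ∈_) (sym (++-assoc xs ys (take 1 R))) x∈)
  ... | inj₁ x∈kept = inj₁ x∈kept
  ... | inj₂ x∈next = inj₂ (∈-take-1 R x∈next)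

module Reachability {a ℓ} {A : Set a} (_<_ : Rel A ℓ) (M : ℕ) where
  open UpDown _<_

  record Reachable (I : List A) (s : State) : Set a where
    field
      read      : List A
      read++inp : I ≡ read ++ inp s
      buf⊆read  : buf s ⊆ read
      full      : ∀ {x} → x ∈ inp s → length (buf s) ≡ M
  open Reachable public

  unwritten-⊆ : ∀ {I s} → Reachable I s → unwritten s ⊆ I
  unwritten-⊆ reach = ⊆-trans (++⁺ (buf⊆read reach) ⊆-refl) (⊆-reflexive (sym (read++inp reach)))

  initial-reachable : ∀ I → Reachable I (initial M I)
  initial-reachable I = record
    { read      = take M I
    ; read++inp = sym (take++drop≡id M I)
    ; buf⊆read  = ⊆-refl
    ; full      = ∈-drop⇒length-take M I
    }

  afterWrite-reachable : ∀ {I xs m ys R} → Reachable I ⟨ xs ++ m ∷ ys , R ⟩ → Reachable I (afterWrite xs ys R)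
  afterWrite-reachable {xs = xs} {m} {ys} {[]} reach = record
    { read      = read reach
    ; read++inp = read++inp reach
    ; buf⊆read  = ⊆-trans (⊆-reflexive (cong (xs ++_) (++-identityʳ ys))) (⊆-trans (⊆-delete xs) (buf⊆read reach))
    ; full      = λ ()
    }
  afterWrite-reachable {xs = xs} {m} {ys} {r ∷ rest} reach = record
    { read      = read reach ++ [ r ]
    ; read++inp = trans (read++inp reach) (sym (++-assoc (read reach) [ r ] rest))
    ; buf⊆read  = subst (_⊆ read reach ++ [ r ]) (++-assoc xs ys [ r ])
                    (++⁺ (⊆-trans (⊆-delete xs) (buf⊆read reach)) ⊆-refl)
    ; full      = λ _ → trans (length-refill xs ys) (full reach (here refl))
    }

module Coupling {a ℓ} {A : Set a} {_<_ : Rel A ℓ} (sto : IsStrictTotalOrder _≡_ _<_) (M : ℕ)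
                {I₁ I₂ : List A} (uI₁ : Unique I₁) (I₂⊆I₁ : I₂ ⊆ I₁) (d : UpDown.Dir _<_) where
  open UpDown _<_
  open States _<_
  open Reachability _<_ M
  open Runs sto d

  unique-unwritten₂ : ∀ {s} → Reachable I₂ s → Unique (unwritten s)
  unique-unwritten₂ reach = Unique-resp-⊇ (⊆-trans (unwritten-⊆ reach) I₂⊆I₁) uI₁

  no-overtaking : ∀ {s₁ r rest P₂ R₂ x} → Reachable I₁ s₁ → inp s₁ ≡ r ∷ rest →
                  I₂ ≡ P₂ ++ R₂ → r ∈ R₂ → x ∈ P₂ → x ∉ inp s₁
  no-overtaking {r = r} {rest} {x = x} reach₁ R₁≡ I₂≡ r∈R₂ x∈P₂ x∈R₁ = not-after-r (subst (x ∈_) R₁≡ x∈R₁)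
    where
      x≺r : Precedes x r I₁
      x≺r = ⊆-trans (subst (Precedes x r) (sym I₂≡) (precedes-++ x∈P₂ r∈R₂)) I₂⊆I₁
      not-after-r : x ∉ r ∷ rest
      not-after-r (here refl)    = precedes-asym uI₁ x≺r x≺r
      not-after-r (there x∈rest) = precedes-asym uI₁ x≺r
        (subst (Precedes r x) (sym (trans (read++inp reach₁) (cong (read reach₁ ++_) R₁≡)))
          (++⁺ˡ (read reach₁) (refl ∷ from∈ x∈rest)))

  capacity : ∀ {xs m ys R₁ r rest s₂} → Reachable I₁ ⟨ xs ++ m ∷ ys , R₁ ⟩ → R₁ ≡ r ∷ rest →
             Reachable I₂ s₂ → unwritten s₂ ⊑ unwritten ⟨ xs ++ m ∷ ys , R₁ ⟩ → m ∉ unwritten s₂ →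
             r ∉ inp s₂
  capacity {xs} {m} {ys} {R₁} {r} {s₂ = s₂} reach₁ R₁≡ reach₂ U₂⊑U₁ m∉U₂ r∈R₂ = 1+n≰n (begin
    suc (length (xs ++ ys))  ≡⟨ sym (length-++-sucʳ xs m ys) ⟩
    length (xs ++ m ∷ ys)    ≡⟨ full reach₁ (subst (r ∈_) (sym R₁≡) (here refl)) ⟩
    M                        ≡⟨ sym (full reach₂ r∈R₂) ⟩
    length (buf s₂)          ≤⟨ length-mono-≤ B₂⊆kept ⟩
    length (xs ++ ys)        ∎)
    where
      open ≤-Reasoning
      B₂⊑kept : buf s₂ ⊑ xs ++ ys
      B₂⊑kept {x} x∈B₂ with ∈-++⁻ (xs ++ m ∷ ys) (U₂⊑U₁ (∈-++⁺ˡ x∈B₂))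
      ... | inj₁ x∈B₁ = ∈-delete xs x∈B₁ λ { refl → m∉U₂ (∈-++⁺ˡ x∈B₂) }
      ... | inj₂ x∈R₁ = ⊥-elim (no-overtaking reach₁ R₁≡ (read++inp reach₂) r∈R₂
                                  (Any-resp-⊆ (buf⊆read reach₂) x∈B₂) x∈R₁)
      B₂⊆kept : buf s₂ ⊆ xs ++ ys
      B₂⊆kept = ⊑⇒⊆ uI₁ (⊆-trans (++⁺ʳ (inp s₂) ⊆-refl) (⊆-trans (unwritten-⊆ reach₂) I₂⊆I₁))
                        (⊆-trans (++⁺ʳ R₁ (⊆-delete xs)) (unwritten-⊆ reach₁)) B₂⊑kept

  next-read-shared : ∀ {s₁ r rest B₂ R₂} → Reachable I₁ s₁ → inp s₁ ≡ r ∷ rest →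
                     Reachable I₂ ⟨ B₂ , R₂ ⟩ → R₂ ⊑ inp s₁ → r ∈ R₂ → R₂ ≡ r ∷ drop 1 R₂
  next-read-shared {R₂ = _ ∷ _} _ _ _ _ (here refl) = refl
  next-read-shared {R₂ = r₂ ∷ R₂} reach₁ R₁≡ reach₂ R₂⊑R₁ (there r∈R₂) =
    ⊥-elim (no-overtaking reach₁ R₁≡ I₂≡ r∈R₂ (∈-++⁺ʳ (read reach₂) (here refl)) (R₂⊑R₁ (here refl)))
    where
      I₂≡ : I₂ ≡ (read reach₂ ++ [ r₂ ]) ++ R₂
      I₂≡ = trans (read++inp reach₂) (sym (++-assoc (read reach₂) [ r₂ ] R₂))

  record Coupled (l₁ : Maybe A) (s₁ : State) (l₂ : Maybe A) (s₂ : State) : Set (a ⊔ ℓ) where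
    field
      unwritten-⊑     : unwritten s₂ ⊑ unwritten s₁
      inp-⊑           : inp s₂ ⊑ inp s₁
      pending-shared  : ∀ {x} → x ∈ unwritten s₂ → Pending l₁ s₁ x → Pending l₂ s₂ x
      pending₁⇒above₂ : ∀ {y} → Pending l₁ s₁ y → l₂ ⊏ y
      pending₂⇒above₁ : ∀ {y} → Pending l₂ s₂ y → l₁ ⊏ y
  open Coupled

  initial-coupled : Coupled nothing (initial M I₁) nothing (initial M I₂)
  initial-coupled = record
    { unwritten-⊑     = Any-resp-⊆ U₂⊆U₁
    ; inp-⊑           = Any-resp-⊆ (drop⁺-⊆ M I₂⊆I₁)
    ; pending-shared  = shared
    ; pending₁⇒above₂ = λ _ → nothing
    ; pending₂⇒above₁ = λ _ → nothing
    }
    where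
      U₂⊆U₁ : unwritten (initial M I₂) ⊆ unwritten (initial M I₁)
      U₂⊆U₁ = ⊆-trans (unwritten-⊆ (initial-reachable I₂))
                (⊆-trans I₂⊆I₁ (⊆-reflexive (sym (take++drop≡id M I₁))))
      shared : ∀ {x} → x ∈ unwritten (initial M I₂) → Pending nothing (initial M I₁) x →
               Pending nothing (initial M I₂) x
      shared {x} x∈U₂ (x∈B₁ , _) with ∈-++⁻ (take M I₂) x∈U₂
      ... | inj₁ x∈B₂ = x∈B₂ , nothing
      ... | inj₂ x∈R₂ = ⊥-elim (precedes-asym uI₁ x≺x x≺x)
        where
          x≺x : Precedes x x I₁
          x≺x = subst (Precedes x x) (take++drop≡id M I₁)
                  (precedes-++ x∈B₁ (Any-resp-⊆ (drop⁺-⊆ M I₂⊆I₁) x∈R₂))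

  step₁ : ∀ {l₁ xs m ys R₁ l₂ s₂} → Reachable I₁ ⟨ xs ++ m ∷ ys , R₁ ⟩ → Reachable I₂ s₂ →
          Coupled l₁ ⟨ xs ++ m ∷ ys , R₁ ⟩ l₂ s₂ → l₁ ⊏ m → (∀ {y} → Pending l₂ s₂ y → m ≺ y) →
          Coupled (just m) (afterWrite xs ys R₁) l₂ s₂
  step₁ {xs = xs} {m} {ys} {R₁} {l₂} {s₂} reach₁ reach₂ c l₁⊏m m≺pending₂ = record
    { unwritten-⊑     = λ x∈ → afterWrite-∋ xs ys R₁ (unwritten-⊑ c x∈) λ { refl → m∉U₂ x∈ }
    ; inp-⊑           = R₂⊑R₁′
    ; pending-shared  = shared
    ; pending₁⇒above₂ = λ { (_ , just m≺y) → ⊏-≺-trans l₂⊏m m≺y }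
    ; pending₂⇒above₁ = λ p → just (m≺pending₂ p)
    }
    where
      m∈B₁ : m ∈ xs ++ m ∷ ys
      m∈B₁ = ∈-insert xs
      l₂⊏m : l₂ ⊏ m
      l₂⊏m = pending₁⇒above₂ c (m∈B₁ , l₁⊏m)
      m∉U₂ : m ∉ unwritten s₂
      m∉U₂ m∈U₂ = ≺-irrefl refl (m≺pending₂ (pending-shared c m∈U₂ (m∈B₁ , l₁⊏m)))
      next₁∉R₂ : ∀ {r} → R₁ ≡ r ∷ drop 1 R₁ → r ∉ inp s₂
      next₁∉R₂ R₁≡ = capacity reach₁ R₁≡ reach₂ (unwritten-⊑ c) m∉U₂
      R₂⊑R₁′ : inp s₂ ⊑ drop 1 R₁
      R₂⊑R₁′ x∈R₂ with ∈-head-or-drop-1 R₁ (inp-⊑ c x∈R₂)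
      ... | inj₁ R₁≡  = ⊥-elim (next₁∉R₂ R₁≡ x∈R₂)
      ... | inj₂ x∈R₁ = x∈R₁
      shared : ∀ {x} → x ∈ unwritten s₂ → Pending (just m) (afterWrite xs ys R₁) x → Pending l₂ s₂ x
      shared x∈U₂ (x∈B₁′ , just m≺x) with buf-afterWrite⁻ xs ys R₁ x∈B₁′ | ∈-++⁻ (buf s₂) x∈U₂
      ... | inj₁ x∈kept | _ = pending-shared c x∈U₂ (Any-resp-⊆ (⊆-delete xs) x∈kept , ⊏-≺-trans l₁⊏m m≺x)
      ... | inj₂ _    | inj₁ x∈B₂ = x∈B₂ , ⊏-≺-trans l₂⊏m m≺x
      ... | inj₂ R₁≡  | inj₂ x∈R₂ = ⊥-elim (next₁∉R₂ R₁≡ x∈R₂)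

  step₂ : ∀ {l₁ s₁ l₂ xs m ys R₂} → Reachable I₂ ⟨ xs ++ m ∷ ys , R₂ ⟩ →
          Coupled l₁ s₁ l₂ ⟨ xs ++ m ∷ ys , R₂ ⟩ → l₂ ⊏ m →
          (∀ {y} → Pending l₂ ⟨ xs ++ m ∷ ys , R₂ ⟩ y → ¬ y ≺ m) → (∀ {y} → Pending l₁ s₁ y → m ≺ y) →
          Coupled l₁ s₁ (just m) (afterWrite xs ys R₂)
  step₂ {l₁} {s₁} {xs = xs} {m} {ys} {R₂} reach₂ c l₂⊏m m-minimal m≺pending₁ = record
    { unwritten-⊑     = λ x∈ → unwritten-⊑ c (Any-resp-⊆ (afterWrite-⊆ xs ys R₂) x∈)
    ; inp-⊑           = λ x∈ → inp-⊑ c (Any-resp-⊆ (drop-⊆ 1 R₂) x∈)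
    ; pending-shared  = shared
    ; pending₁⇒above₂ = λ p → just (m≺pending₁ p)
    ; pending₂⇒above₁ = λ { (_ , just m≺y) → ⊏-≺-trans (pending₂⇒above₁ c (∈-insert xs , l₂⊏m)) m≺y }
    }
    where
      shared : ∀ {x} → x ∈ unwritten (afterWrite xs ys R₂) → Pending l₁ s₁ x →
               Pending (just m) (afterWrite xs ys R₂) x
      shared x∈U₂′ p₁ with pending-shared c (Any-resp-⊆ (afterWrite-⊆ xs ys R₂) x∈U₂′) p₁
      ... | x∈B₂ , l₂⊏x =
        Any-resp-⊆ (kept-⊆-buf xs ys R₂) (∈-delete xs x∈B₂ x≢m) , just (≮∧≢⇒≻ (m-minimal (x∈B₂ , l₂⊏x)) x≢m)
        where
          x≢m = afterWrite-∌ xs ys R₂ (unique-unwritten₂ reach₂) x∈U₂′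

  step-both : ∀ {l₁ xs₁ m ys₁ R₁ l₂ xs₂ ys₂ R₂} →
              Reachable I₁ ⟨ xs₁ ++ m ∷ ys₁ , R₁ ⟩ → Reachable I₂ ⟨ xs₂ ++ m ∷ ys₂ , R₂ ⟩ →
              Coupled l₁ ⟨ xs₁ ++ m ∷ ys₁ , R₁ ⟩ l₂ ⟨ xs₂ ++ m ∷ ys₂ , R₂ ⟩ → l₁ ⊏ m →
              Coupled (just m) (afterWrite xs₁ ys₁ R₁) (just m) (afterWrite xs₂ ys₂ R₂)
  step-both {xs₁ = xs₁} {m} {ys₁} {R₁} {xs₂ = xs₂} {ys₂} {R₂} reach₁ reach₂ c l₁⊏m = record
    { unwritten-⊑     = λ x∈ → afterWrite-∋ xs₁ ys₁ R₁ (unwritten-⊑ c (U₂′⊑U₂ x∈)) (≢m x∈)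
    ; inp-⊑           = R₂′⊑R₁′
    ; pending-shared  = shared
    ; pending₁⇒above₂ = λ (_ , m⊏y) → m⊏y
    ; pending₂⇒above₁ = λ (_ , m⊏y) → m⊏y
    }
    where
      U₂′⊑U₂ : unwritten (afterWrite xs₂ ys₂ R₂) ⊑ unwritten ⟨ xs₂ ++ m ∷ ys₂ , R₂ ⟩
      U₂′⊑U₂ = Any-resp-⊆ (afterWrite-⊆ xs₂ ys₂ R₂)
      ≢m : ∀ {x} → x ∈ unwritten (afterWrite xs₂ ys₂ R₂) → x ≢ m
      ≢m = afterWrite-∌ xs₂ ys₂ R₂ (unique-unwritten₂ reach₂)
      shared-next : ∀ {r} → R₁ ≡ r ∷ drop 1 R₁ → r ∈ R₂ → R₂ ≡ r ∷ drop 1 R₂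
      shared-next R₁≡ = next-read-shared reach₁ R₁≡ reach₂ (inp-⊑ c)
      R₂′⊑R₁′ : drop 1 R₂ ⊑ drop 1 R₁
      R₂′⊑R₁′ x∈R₂′ with ∈-head-or-drop-1 R₁ (inp-⊑ c (Any-resp-⊆ (drop-⊆ 1 R₂) x∈R₂′))
      ... | inj₂ x∈R₁′ = x∈R₁′
      ... | inj₁ R₁≡   = ⊥-elim (Unique[x∷xs]⇒x∉xs (subst Unique R₂≡ uR₂) x∈R₂′)
        where
          R₂≡ = shared-next R₁≡ (Any-resp-⊆ (drop-⊆ 1 R₂) x∈R₂′)
          uR₂ = Unique-resp-⊇ (++⁺ˡ (xs₂ ++ m ∷ ys₂) ⊆-refl) (unique-unwritten₂ reach₂)
      kept₂ : ∀ {x} → x ∈ unwritten (afterWrite xs₂ ys₂ R₂) → x ∈ xs₂ ++ m ∷ ys₂ →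
              x ∈ buf (afterWrite xs₂ ys₂ R₂)
      kept₂ x∈U₂′ x∈B₂ = Any-resp-⊆ (kept-⊆-buf xs₂ ys₂ R₂) (∈-delete xs₂ x∈B₂ (≢m x∈U₂′))
      shared : ∀ {x} → x ∈ unwritten (afterWrite xs₂ ys₂ R₂) → Pending (just m) (afterWrite xs₁ ys₁ R₁) x →
               Pending (just m) (afterWrite xs₂ ys₂ R₂) x
      shared x∈U₂′ (x∈B₁′ , just m≺x) with buf-afterWrite⁻ xs₁ ys₁ R₁ x∈B₁′ | ∈-++⁻ (xs₂ ++ m ∷ ys₂) (U₂′⊑U₂ x∈U₂′)
      ... | inj₁ x∈kept | _ =
        kept₂ x∈U₂′ (proj₁ (pending-shared c (U₂′⊑U₂ x∈U₂′) (Any-resp-⊆ (⊆-delete xs₁) x∈kept , ⊏-≺-trans l₁⊏m m≺x)))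
        , just m≺x
      ... | inj₂ _   | inj₁ x∈B₂ = kept₂ x∈U₂′ x∈B₂ , just m≺x
      ... | inj₂ R₁≡ | inj₂ x∈R₂ = next-read-∈-buf xs₂ ys₂ (shared-next R₁≡ x∈R₂) , just m≺x

  writes-reachable : ∀ {I l s w t} → Reachable I s → Writes l s w t → Reachable I t
  writes-reachable reach (stop _)          = reach
  writes-reachable reach (next refl _ _ W) = writes-reachable (afterWrite-reachable reach) W

  coupled-after-stop₁ : ∀ {l₁ s₁ l₂ s₂ w₂ t₂} → Reachable I₂ s₂ → Coupled l₁ s₁ l₂ s₂ →
                        (∀ {y} → ¬ Pending l₁ s₁ y) → Writes l₂ s₂ w₂ t₂ → unwritten t₂ ⊑ unwritten s₁
  coupled-after-stop₁ _ c _ (stop _) = unwritten-⊑ c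
  coupled-after-stop₁ reach₂ c stopped₁ (next refl l₂⊏m minimal₂ W₂) =
    coupled-after-stop₁ (afterWrite-reachable reach₂)
      (step₂ reach₂ c l₂⊏m minimal₂ (λ p → ⊥-elim (stopped₁ p))) stopped₁ W₂

  coupled-writes : ∀ {l₁ s₁ w₁ t₁ l₂ s₂ w₂ t₂} → Reachable I₁ s₁ → Reachable I₂ s₂ → Coupled l₁ s₁ l₂ s₂ →
                   Writes l₁ s₁ w₁ t₁ → Writes l₂ s₂ w₂ t₂ → unwritten t₂ ⊑ unwritten t₁
  -- Run 1 is about to write m; splitting this case off keeps the recursion structural.
  coupled-next : ∀ {l₁ xs m ys R₁ w₁ t₁ l₂ s₂ w₂ t₂} → Reachable I₁ ⟨ xs ++ m ∷ ys , R₁ ⟩ → Reachable I₂ s₂ →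
                 Coupled l₁ ⟨ xs ++ m ∷ ys , R₁ ⟩ l₂ s₂ → l₁ ⊏ m →
                 (∀ {y} → Pending l₁ ⟨ xs ++ m ∷ ys , R₁ ⟩ y → ¬ y ≺ m) →
                 Writes (just m) (afterWrite xs ys R₁) w₁ t₁ → Writes l₂ s₂ w₂ t₂ → unwritten t₂ ⊑ unwritten t₁

  coupled-writes _      reach₂ c (stop stopped₁)              W₂ = coupled-after-stop₁ reach₂ c stopped₁ W₂
  coupled-writes reach₁ reach₂ c (next refl l₁⊏m minimal₁ W₁) W₂ = coupled-next reach₁ reach₂ c l₁⊏m minimal₁ W₁ W₂

  coupled-next reach₁ reach₂ c l₁⊏m _ W₁ (stop stopped₂) =
    coupled-writes (afterWrite-reachable reach₁) reach₂
      (step₁ reach₁ reach₂ c l₁⊏m (λ p → ⊥-elim (stopped₂ p))) W₁ (stop stopped₂)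
  coupled-next {m = m₁} reach₁ reach₂ c l₁⊏m₁ minimal₁ W₁ (next {x = m₂} refl l₂⊏m₂ minimal₂ W₂)
    with compare m₁ m₂
  ... | tri< m₁≺m₂ _ _ =
    coupled-writes (afterWrite-reachable reach₁) reach₂
      (step₁ reach₁ reach₂ c l₁⊏m₁ (λ p → ≺-≮-trans m₁≺m₂ (minimal₂ p))) W₁ (next refl l₂⊏m₂ minimal₂ W₂)
  ... | tri> _ _ m₂≺m₁ =
    coupled-next reach₁ (afterWrite-reachable reach₂)
      (step₂ reach₂ c l₂⊏m₂ minimal₂ (λ p → ≺-≮-trans m₂≺m₁ (minimal₁ p))) l₁⊏m₁ minimal₁ W₁ W₂
  ... | tri≈ _ refl _ =
    coupled-writes (afterWrite-reachable reach₁) (afterWrite-reachable reach₂)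
      (step-both reach₁ reach₂ c l₁⊏m₁) W₁ W₂

  first-run-reachable : ∀ {I r t} → Run d (initial M I) r t → Reachable I t
  first-run-reachable R = writes-reachable (initial-reachable _) (Run⇒Writes R)

  first-runs : ∀ {r₁ r₂ t₁ t₂} → Run d (initial M I₁) r₁ t₁ → Run d (initial M I₂) r₂ t₂ →
               unwritten t₂ ⊑ unwritten t₁
  first-runs R₁ R₂ = coupled-writes (initial-reachable I₁) (initial-reachable I₂) initial-coupled
                       (Run⇒Writes R₁) (Run⇒Writes R₂)

lemma4 : ∀ {a ℓ} {A : Set a} {_<_ : Rel A ℓ} → IsStrictTotalOrder _≡_ _<_ →
    (M : ℕ) (I₁ I₂ : List A) → Unique I₁ → I₂ ⊆ I₁ →
    (d : UpDown.Dir _<_) (r₁ r₂ S₁' S₂' : List A) (s₁ s₂ : UpDown.State _<_) →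
    UpDown.Run _<_ d (UpDown.initial _<_ M I₁) r₁ s₁ → UpDown.Proper _<_ s₁ S₁' →
    UpDown.Run _<_ d (UpDown.initial _<_ M I₂) r₂ s₂ → UpDown.Proper _<_ s₂ S₂' →
    UpDown.unwritten _<_ s₂ ⊆ UpDown.unwritten _<_ s₁
lemma4 {_<_ = _<_} sto M I₁ I₂ uI₁ I₂⊆I₁ d _ _ _ _ _ _ run₁ _ run₂ _ =
  ⊑⇒⊆ uI₁ (⊆-trans (unwritten-⊆ (first-run-reachable run₂)) I₂⊆I₁) (unwritten-⊆ (first-run-reachable run₁))
    (first-runs run₁ run₂)
  where
    open Coupling sto M uI₁ I₂⊆I₁ d
    open Reachability _<_ M using (unwritten-⊆)
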